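{- Let $H=(V,\mathcal F)$ be a hypergraph in which every edge has at least two vertices, except possibly for one edge that has exactly one vertex; if $H$ has a one-vertex edge $e=\{v\}$, assume that some other edge $f$ of $H$ contains $v$. Then $H$ has a hitting set of cardinality at most $(|V|+|\mathcal F|)/3$.
   Context: A hypergraph $H=(V,\mathcal F)$ has a nonempty finite vertex set $V$ and a family $\mathcal F$ of nonempty subsets of $V$ (edges), parallel edges allowed. A hitting set is a set $S\subseteq V$ with $S\cap e\neq\emptyset$ for every $e\in\mathcal F$. -}

module Defs where

open import Data.Nat using (ℕ; _≤_; _*_; _+_; NonZero)
open import Data.Fin using (Fin)
open import Data.Fin.Subset using (Subset; ∣_∣; _∈_; Nonempty)
open import Data.Product using (Σ; ∃; _×_; _,_)
open import Data.Sum using (_⊎_)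
open import Relation.Binary.PropositionalEquality using (_≡_; _≢_)

-- A hypergraph on vertex set Fin n with m edges (parallel edges allowed),
-- given as an indexed family of subsets of the vertex set.
Hypergraph : ℕ → ℕ → Set
Hypergraph n m = Fin m → Subset n

EdgesNonempty : ∀ {n m} → Hypergraph n m → Set
EdgesNonempty {m = m} F = (i : Fin m) → Nonempty (F i)

IsHittingSet : ∀ {n m} → Hypergraph n m → Subset n → Set
IsHittingSet {n} {m} F S = (i : Fin m) → Σ (Fin n) λ v → v ∈ S × v ∈ F i

AtMostOneSingleton : ∀ {n m} → Hypergraph n m → Set
AtMostOneSingleton {m = m} F =
  (i j : Fin m) → i ≢ j → (2 ≤ ∣ F i ∣) ⊎ (2 ≤ ∣ F j ∣)

SingletonCovered : ∀ {n m} → Hypergraph n m → Set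
SingletonCovered {n} {m} F =
  (i : Fin m) → ∣ F i ∣ ≡ 1 → (v : Fin n) → v ∈ F i →
    Σ (Fin m) λ j → i ≢ j × v ∈ F j

module Submission where

open import Defs
open import Data.Nat using (ℕ; _≤_; _*_; _+_; NonZero)
open import Data.Fin.Subset using (Subset; ∣_∣)
open import Data.Product using (Σ; _×_)

open import Data.Nat using (suc; _<_; z≤n; s≤s; s≤s⁻¹; _<?_)
open import Data.Nat.Properties
open import Algebra.Properties.CommutativeSemigroup +-commutativeSemigroup using (interchange)
open import Data.Fin using (Fin; zero)
import Data.Fin.Properties as Fin
open import Data.Fin.Subset using (_∈_; _∉_; _⊆_; _∪_; _∩_; _─_; ⁅_⁆; ⊤; ⊥; Nonempty; inside; outside)
open import Data.Fin.Subset.Properties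
open import Data.Vec using ([]; _∷_; tabulate)
open import Data.Vec.Base using (_[_]=_)
open _[_]=_
open import Data.Vec.Properties using (lookup∘tabulate; []=⇒lookup; lookup⇒[]=)
open import Data.Product using (_,_; proj₁; proj₂; ∃-syntax)
open import Data.Sum using (_⊎_; inj₁; inj₂)
open import Relation.Nullary using (Dec; yes; no; ¬_; does; contradiction)
open import Relation.Nullary.Decidable using (_×-dec_; ¬?; dec-true)
open import Relation.Binary.PropositionalEquality using (_≡_; refl; sym; trans; cong; cong₂; subst; _≢_)

-- We prove a stronger, inductive statement: if W is a set of
-- vertices and E a set of edges, each contained in W and of size at least 2,
-- then E has a hitting set S with 3|S| ≤ |W| + |E|.  Induction on |E| uses
-- a "reduction": choose a vertex v, delete a set R ⊆ W of vertices and a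
-- nonempty set D ⊆ E of edges through v, with |R| + |D| ≥ 3 and the
-- surviving edges disjoint from R; then a small cover of the rest plus v
-- is a small cover of (W, E).  A reduction always exists: if some edge
-- shares a vertex v with another edge, delete v and all edges through it
-- (|R| = 1, |D| ≥ 2); otherwise some edge e is isolated, and we delete its
-- vertices and e itself (|R| ≥ 2, |D| = 1).  For the theorem, W and E are
-- everything; if there is a one-vertex edge {v}, the first kind of
-- reduction at v (which lies in a second edge) removes it, and every
-- surviving edge has size at least 2, so the inductive statement applies.

∣p∪q∣≤∣p∣+∣q∣ : ∀ {n} (p q : Subset n) → ∣ p ∪ q ∣ ≤ ∣ p ∣ + ∣ q ∣
∣p∪q∣≤∣p∣+∣q∣ []            []            = z≤n
∣p∪q∣≤∣p∣+∣q∣ (inside ∷ p)  (inside ∷ q)  =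
  s≤s (≤-trans (∣p∪q∣≤∣p∣+∣q∣ p q) (≤-trans (n≤1+n _) (≤-reflexive (sym (+-suc (∣ p ∣) (∣ q ∣))))))
∣p∪q∣≤∣p∣+∣q∣ (inside ∷ p)  (outside ∷ q) = s≤s (∣p∪q∣≤∣p∣+∣q∣ p q)
∣p∪q∣≤∣p∣+∣q∣ (outside ∷ p) (inside ∷ q)  =
  ≤-trans (s≤s (∣p∪q∣≤∣p∣+∣q∣ p q)) (≤-reflexive (sym (+-suc (∣ p ∣) (∣ q ∣))))
∣p∪q∣≤∣p∣+∣q∣ (outside ∷ p) (outside ∷ q) = ∣p∪q∣≤∣p∣+∣q∣ p q

∣p─q∣+∣q∣≡∣p∣ : ∀ {n} (p q : Subset n) → q ⊆ p → ∣ p ─ q ∣ + ∣ q ∣ ≡ ∣ p ∣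
∣p─q∣+∣q∣≡∣p∣ []            []            _   = refl
∣p─q∣+∣q∣≡∣p∣ (inside ∷ p)  (inside ∷ q)  q⊆p =
  trans (+-suc (∣ p ─ q ∣) (∣ q ∣)) (cong suc (∣p─q∣+∣q∣≡∣p∣ p q (drop-∷-⊆ q⊆p)))
∣p─q∣+∣q∣≡∣p∣ (outside ∷ p) (inside ∷ q)  q⊆p with q⊆p here
... | ()
∣p─q∣+∣q∣≡∣p∣ (inside ∷ p)  (outside ∷ q) q⊆p = cong suc (∣p─q∣+∣q∣≡∣p∣ p q (drop-∷-⊆ q⊆p))
∣p─q∣+∣q∣≡∣p∣ (outside ∷ p) (outside ∷ q) q⊆p = ∣p─q∣+∣q∣≡∣p∣ p q (drop-∷-⊆ q⊆p)

nonempty⇒∣p∣≥1 : ∀ {n} {p : Subset n} → Nonempty p → 1 ≤ ∣ p ∣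
nonempty⇒∣p∣≥1 {p = p} (x , x∈p) = subst (_≤ ∣ p ∣) (∣⁅x⁆∣≡1 x)
  (p⊆q⇒∣p∣≤∣q∣ (λ y∈⁅x⁆ → subst (_∈ p) (sym (x∈⁅y⁆⇒x≡y x y∈⁅x⁆)) x∈p))

∣p∣≥1⇒nonempty : ∀ {n} {p : Subset n} → 1 ≤ ∣ p ∣ → Nonempty p
∣p∣≥1⇒nonempty {n} {p} ∣p∣≥1 with nonempty? p
... | yes ne = ne
... | no empty = contradiction (trans (cong ∣_∣ (Empty-unique empty)) (∣⊥∣≡0 n)) (m<n⇒n≢0 ∣p∣≥1)

distinct⇒∣p∣≥2 : ∀ {n} {p : Subset n} {x y} → x ∈ p → y ∈ p → x ≢ y → 2 ≤ ∣ p ∣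
distinct⇒∣p∣≥2 x∈p y∈p x≢y =
  ≤-trans (s≤s (nonempty⇒∣p∣≥1 (_ , x∈p∧x≢y⇒x∈p-y y∈p (λ y≡x → x≢y (sym y≡x)))))
          (x∈p⇒∣p-x∣<∣p∣ x∈p)

x∈p─q⇒x∉q : ∀ {n} (p q : Subset n) {x} → x ∈ p ─ q → x ∉ q
x∈p─q⇒x∉q (_ ∷ p) (_ ∷ q)       (there x∈p─q) (there x∈q) = x∈p─q⇒x∉q p q x∈p─q x∈q
x∈p─q⇒x∉q (_ ∷ p) (inside ∷ q)  {zero} ()

⊆-avoiding : ∀ {n} {p W R : Subset n} → p ⊆ W → (∀ {x} → x ∈ p → x ∉ R) → p ⊆ W ─ R
⊆-avoiding p⊆W avoids x∈p = x∈p∧x∉q⇒x∈p─q (p⊆W x∈p) (avoids x∈p)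

module SmallCovers {n m : ℕ} (F : Hypergraph n m) where

  Hits : Subset n → Fin m → Set
  Hits S i = Σ (Fin n) λ v → v ∈ S × v ∈ F i

  Admissible : Subset n → Subset m → Set
  Admissible W E = ∀ {i} → i ∈ E → F i ⊆ W × 2 ≤ ∣ F i ∣

  SmallCover : Subset n → Subset m → Set
  SmallCover W E = Σ (Subset n) λ S → (∀ {i} → i ∈ E → Hits S i) × 3 * ∣ S ∣ ≤ ∣ W ∣ + ∣ E ∣

  -- One step of the induction: taking the vertex v into the cover pays for
  -- deleting the vertices R and the edges D (all through v), since |R| + |D| ≥ 3.
  record Reduction (W : Subset n) (E : Subset m) : Set where
    field
      vertex   : Fin n
      R        : Subset n
      D        : Subset m
      R⊆W      : R ⊆ W
      D⊆E      : D ⊆ E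
      through  : ∀ {i} → i ∈ D → vertex ∈ F i
      avoids   : ∀ {i} → i ∈ E ─ D → ∀ {x} → x ∈ F i → x ∉ R
      D≢∅      : 1 ≤ ∣ D ∣
      weight   : 3 ≤ ∣ R ∣ + ∣ D ∣

  module _ {W : Subset n} {E : Subset m} (r : Reduction W E) where
    open Reduction r

    extend : SmallCover (W ─ R) (E ─ D) → SmallCover W E
    extend (S , hits , bound) = S ∪ ⁅ vertex ⁆ , hits′ , bound′
      where
      v∈S′ : vertex ∈ S ∪ ⁅ vertex ⁆
      v∈S′ = x∈p∪q⁺ (inj₂ (x∈⁅x⁆ vertex))

      hits′ : ∀ {i} → i ∈ E → Hits (S ∪ ⁅ vertex ⁆) i
      hits′ {i} i∈E with i ∈? D
      ... | yes i∈D = vertex , v∈S′ , through i∈D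
      ... | no  i∉D with hits (x∈p∧x∉q⇒x∈p─q i∈E i∉D)
      ...   | u , u∈S , u∈Fi = u , x∈p∪q⁺ (inj₁ u∈S) , u∈Fi

      open ≤-Reasoning
      bound′ : 3 * ∣ S ∪ ⁅ vertex ⁆ ∣ ≤ ∣ W ∣ + ∣ E ∣
      bound′ = begin
        3 * ∣ S ∪ ⁅ vertex ⁆ ∣
          ≤⟨ *-monoʳ-≤ 3 (subst (∣ S ∪ ⁅ vertex ⁆ ∣ ≤_) (cong (∣ S ∣ +_) (∣⁅x⁆∣≡1 vertex))
                                (∣p∪q∣≤∣p∣+∣q∣ S ⁅ vertex ⁆)) ⟩
        3 * (∣ S ∣ + 1)                              ≡⟨ *-distribˡ-+ 3 ∣ S ∣ 1 ⟩
        3 * ∣ S ∣ + 3                                ≤⟨ +-mono-≤ bound weight ⟩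
        (∣ W ─ R ∣ + ∣ E ─ D ∣) + (∣ R ∣ + ∣ D ∣)   ≡⟨ interchange (∣ W ─ R ∣) (∣ E ─ D ∣) (∣ R ∣) (∣ D ∣) ⟩
        (∣ W ─ R ∣ + ∣ R ∣) + (∣ E ─ D ∣ + ∣ D ∣)   ≡⟨ cong₂ _+_ (∣p─q∣+∣q∣≡∣p∣ W R R⊆W) (∣p─q∣+∣q∣≡∣p∣ E D D⊆E) ⟩
        ∣ W ∣ + ∣ E ∣                                ∎

    fewerEdges : ∣ E ─ D ∣ < ∣ E ∣
    fewerEdges = subst (∣ E ─ D ∣ <_) (∣p─q∣+∣q∣≡∣p∣ E D D⊆E)
      (subst (_≤ ∣ E ─ D ∣ + ∣ D ∣) (+-comm ∣ E ─ D ∣ 1) (+-monoʳ-≤ ∣ E ─ D ∣ D≢∅))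

    admissibleAfter : Admissible W (E ─ D) → Admissible (W ─ R) (E ─ D)
    admissibleAfter adm i∈E─D with adm i∈E─D
    ... | Fi⊆W , ∣Fi∣≥2 = ⊆-avoiding Fi⊆W (avoids i∈E─D) , ∣Fi∣≥2

  incident : Fin n → Subset m
  incident v = tabulate λ i → does (v ∈? F i)

  ∈incident⁺ : ∀ {v i} → v ∈ F i → i ∈ incident v
  ∈incident⁺ {v} {i} v∈Fi =
    lookup⇒[]= i (incident v) (trans (lookup∘tabulate _ i) (dec-true (v ∈? F i) v∈Fi))

  ∈incident⁻ : ∀ {v i} → i ∈ incident v → v ∈ F i
  ∈incident⁻ {v} {i} i∈ with v ∈? F i | trans (sym (lookup∘tabulate _ i)) ([]=⇒lookup i∈)
  ... | yes v∈Fi | _  = v∈Fi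
  ... | no  _    | ()

  starReduction : ∀ {W E v i j} → v ∈ W → i ∈ E → j ∈ E → i ≢ j → v ∈ F i → v ∈ F j →
                  Reduction W E
  starReduction {W} {E} {v} {i} {j} v∈W i∈E j∈E i≢j v∈Fi v∈Fj = record
    { vertex  = v
    ; R       = ⁅ v ⁆
    ; D       = E ∩ incident v
    ; R⊆W     = λ x∈⁅v⁆ → subst (_∈ W) (sym (x∈⁅y⁆⇒x≡y v x∈⁅v⁆)) v∈W
    ; D⊆E     = p∩q⊆p E (incident v)
    ; through = λ k∈D → ∈incident⁻ (proj₂ (x∈p∩q⁻ E (incident v) k∈D))
    ; avoids  = avoids
    ; D≢∅     = ≤-trans (s≤s z≤n) ∣D∣≥2
    ; weight  = subst (λ k → 3 ≤ k + ∣ E ∩ incident v ∣) (sym (∣⁅x⁆∣≡1 v)) (s≤s ∣D∣≥2)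
    }
    where
    ∣D∣≥2 : 2 ≤ ∣ E ∩ incident v ∣
    ∣D∣≥2 = distinct⇒∣p∣≥2 (x∈p∩q⁺ (i∈E , ∈incident⁺ v∈Fi)) (x∈p∩q⁺ (j∈E , ∈incident⁺ v∈Fj)) i≢j

    avoids : ∀ {k} → k ∈ E ─ E ∩ incident v → ∀ {x} → x ∈ F k → x ∉ ⁅ v ⁆
    avoids {k} k∈E─D x∈Fk x∈⁅v⁆ = x∈p─q⇒x∉q E D k∈E─D (x∈p∩q⁺ (p─q⊆p E D k∈E─D , ∈incident⁺ v∈Fk))
      where
      D : Subset m
      D = E ∩ incident v
      v∈Fk : v ∈ F k
      v∈Fk = subst (_∈ F k) (x∈⁅y⁆⇒x≡y v x∈⁅v⁆) x∈Fk

  Meets : Subset m → Fin m → Set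
  Meets E i = ∃[ v ] v ∈ F i × ∃[ j ] j ∈ E × i ≢ j × v ∈ F j

  meets? : ∀ E i → Dec (Meets E i)
  meets? E i = Fin.any? λ v → v ∈? F i ×-dec
               Fin.any? λ j → j ∈? E ×-dec ¬? (i Fin.≟ j) ×-dec v ∈? F j

  isolatedReduction : ∀ {W E i} → Admissible W E → i ∈ E → ¬ Meets E i → Reduction W E
  isolatedReduction {W} {E} {i} adm i∈E isolated = record
    { vertex  = proj₁ v∈Fi
    ; R       = F i
    ; D       = ⁅ i ⁆
    ; R⊆W     = proj₁ (adm i∈E)
    ; D⊆E     = λ k∈⁅i⁆ → subst (_∈ E) (sym (x∈⁅y⁆⇒x≡y i k∈⁅i⁆)) i∈E
    ; through = λ k∈⁅i⁆ → subst (λ k → proj₁ v∈Fi ∈ F k) (sym (x∈⁅y⁆⇒x≡y i k∈⁅i⁆)) (proj₂ v∈Fi)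
    ; avoids  = avoids
    ; D≢∅     = ≤-reflexive (sym (∣⁅x⁆∣≡1 i))
    ; weight  = subst (λ d → 3 ≤ ∣ F i ∣ + d) (sym (∣⁅x⁆∣≡1 i)) (+-monoˡ-≤ 1 ∣Fi∣≥2)
    }
    where
    ∣Fi∣≥2 : 2 ≤ ∣ F i ∣
    ∣Fi∣≥2 = proj₂ (adm i∈E)

    v∈Fi : Nonempty (F i)
    v∈Fi = ∣p∣≥1⇒nonempty (≤-trans (s≤s z≤n) ∣Fi∣≥2)

    avoids : ∀ {k} → k ∈ E ─ ⁅ i ⁆ → ∀ {x} → x ∈ F k → x ∉ F i
    avoids {k} k∈E─i {x} x∈Fk x∈Fi =
      isolated (x , x∈Fi , k , p─q⊆p E ⁅ i ⁆ k∈E─i , i≢k , x∈Fk)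
      where
      i≢k : i ≢ k
      i≢k refl = x∈p─q⇒x∉q E ⁅ i ⁆ k∈E─i (x∈⁅x⁆ i)

  reduction : ∀ {W E} → Admissible W E → Nonempty E → Reduction W E
  reduction {E = E} adm (i , i∈E) with meets? E i
  ... | yes (v , v∈Fi , j , j∈E , i≢j , v∈Fj) =
    starReduction (proj₁ (adm i∈E) v∈Fi) i∈E j∈E i≢j v∈Fi v∈Fj
  ... | no isolated = isolatedReduction adm i∈E isolated

  emptyCover : ∀ {W E} → ¬ Nonempty E → SmallCover W E
  emptyCover {W} {E} E-empty =
    ⊥ , (λ i∈E → contradiction (_ , i∈E) E-empty) ,
    subst (λ s → 3 * s ≤ ∣ W ∣ + ∣ E ∣) (sym (∣⊥∣≡0 n)) z≤n

  smallCoverBelow : ∀ k {W E} → ∣ E ∣ < k → Admissible W E → SmallCover W E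
  smallCoverBelow (suc k) {W} {E} ∣E∣≤k adm with nonempty? E
  ... | no  E-empty = emptyCover {W} E-empty
  ... | yes E≢∅ = extend r (smallCoverBelow k (<-≤-trans (fewerEdges r) (s≤s⁻¹ ∣E∣≤k))
                                            (admissibleAfter r (λ i∈ → adm (p─q⊆p E _ i∈))))
    where
    r : Reduction W E
    r = reduction adm E≢∅

  smallCover : ∀ {W E} → Admissible W E → SmallCover W E
  smallCover {E = E} = smallCoverBelow (suc ∣ E ∣) ≤-refl

  -- A one-vertex edge i₀ whose vertex v lies in a second edge j: the star
  -- reduction at v removes i₀, and by the hypothesis on one-vertex edges
  -- every surviving edge has at least two vertices.
  coverPastSingleton : AtMostOneSingleton F → ∀ {i₀ j v} → ∣ F i₀ ∣ < 2 → i₀ ≢ j →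
                       v ∈ F i₀ → v ∈ F j → SmallCover ⊤ ⊤
  coverPastSingleton amo {i₀} {j} {v} small i₀≢j v∈Fi₀ v∈Fj =
    extend r (smallCover (admissibleAfter r rest))
    where
    r : Reduction ⊤ ⊤
    r = starReduction ∈⊤ ∈⊤ ∈⊤ i₀≢j v∈Fi₀ v∈Fj

    rest : Admissible ⊤ (⊤ ─ Reduction.D r)
    rest {k} k∈rest = ⊆⊤ , ∣Fk∣≥2 (amo k i₀ k≢i₀)
      where
      k≢i₀ : k ≢ i₀
      k≢i₀ refl = Reduction.avoids r k∈rest v∈Fi₀ (x∈⁅x⁆ v)

      ∣Fk∣≥2 : (2 ≤ ∣ F k ∣) ⊎ (2 ≤ ∣ F i₀ ∣) → 2 ≤ ∣ F k ∣
      ∣Fk∣≥2 (inj₁ ∣Fk∣≥2)  = ∣Fk∣≥2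
      ∣Fk∣≥2 (inj₂ ∣Fi₀∣≥2) = contradiction ∣Fi₀∣≥2 (<⇒≱ small)

  hittingSet : SmallCover ⊤ ⊤ → Σ (Subset n) λ S → IsHittingSet F S × 3 * ∣ S ∣ ≤ n + m
  hittingSet (S , hits , bound) =
    S , (λ i → hits ∈⊤) , subst (3 * ∣ S ∣ ≤_) (cong₂ _+_ (∣⊤∣≡n n) (∣⊤∣≡n m)) bound

lemma7 : (n m : ℕ) → .{{_ : NonZero n}} → (F : Hypergraph n m) →
    EdgesNonempty F → AtMostOneSingleton F → SingletonCovered F →
    Σ (Subset n) λ S → IsHittingSet F S × 3 * ∣ S ∣ ≤ n + m
lemma7 n m F nonempty amo covered = hittingSet cover
  where
  open SmallCovers F

  cover : SmallCover ⊤ ⊤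
  cover with Fin.any? (λ i → ∣ F i ∣ <? 2)
  ... | no noSmallEdge = smallCover (λ {i} _ → ⊆⊤ , ≮⇒≥ (λ small → noSmallEdge (i , small)))
  ... | yes (i₀ , small) with nonempty i₀
  ...   | v , v∈Fi₀ with covered i₀ (≤-antisym (s≤s⁻¹ small) (nonempty⇒∣p∣≥1 (v , v∈Fi₀))) v v∈Fi₀
  ...     | j , i₀≢j , v∈Fj = coverPastSingleton amo small i₀≢j v∈Fi₀ v∈Fj
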